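{- Let $n, t', r$ be positive integers and let $T$ be a $(t'+2r)$-element subset of $[n]$. For any distinct subsets $A, B\in \binom{T}{r+t'}$, there exist subsets $A_1, A_2, \ldots, A_{2w} \in \binom{T}{r+t'}$ such that (1) $|A_i \cap A_{i+1}|=t'$ for $i=1,\ldots, 2w-1$; (2) $A_1=B$ and $A_{2w}=A$, where $w=\left\lfloor\frac{|A \cap B|}{t'}\right\rfloor+1$.
   Context: $[n]=\{1,\dots,n\}$ and $\binom{X}{k}$ denotes the family of all $k$-element subsets of $X$. -}

module Defs where

open import Data.Nat using (ℕ)
open import Data.Fin.Subset using (Subset; _⊆_; ∣_∣)
open import Data.Product using (_×_)
open import Relation.Binary.PropositionalEquality using (_≡_)

InBinom : ∀ {n} → Subset n → ℕ → Subset n → Set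
InBinom T k S = S ⊆ T × ∣ S ∣ ≡ k

{-# OPTIONS --safe #-}
-- Call two (r + t)-subsets V, W of T adjacent when |V ∩ W| = t. Counting inside T gives
-- |V ∩ W| = t + |T ∖ (V ∪ W)|, so V and W share at least t points and are adjacent exactly
-- when they cover T; hence T ∖ X is adjacent to both V and W for every r-subset X of V ∩ W.
-- To move from B towards A, exchange j = min(t, |T ∖ (A ∪ B)|) points of A ∩ B for points of T
-- outside A ∪ B: the new set D still meets B in at least r points, so B and D have a common
-- neighbour, and |A ∩ D| = |A ∩ B| − j. Since |A ∩ B| = t + |T ∖ (A ∪ B)|, each such double step
-- either lowers |A ∩ B| by t or brings it down to t, where the current set is adjacent to A;
-- starting from |A ∩ B| ≤ (q + 1) t with q = ⌊|A ∩ B| / t⌋ this yields a walk through 2(q + 1) sets.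
module Submission where

open import Defs
open import Data.Nat using (ℕ; zero; suc; _+_; _*_; _≤_; _<_; _⊓_; NonZero; z≤n; s≤s)
open import Data.Nat.DivMod using (_/_; _%_; m≡m%n+[m/n]*n; m%n<n)
open import Data.Nat.Properties
open import Algebra.Properties.CommutativeSemigroup +-commutativeSemigroup using (xy∙z≈xz∙y)
open import Data.Nat.Tactic.RingSolver using (solve-∀)
open import Data.Fin.Subset using (Subset; _∩_; _∪_; ∁; ⊥; _⊆_; ∣_∣; inside; outside)
open import Data.Fin.Subset.Properties
open import Data.Product using (Σ; _×_; _,_; ∃-syntax)
open import Data.Sum using (inj₁; inj₂)
open import Data.Vec using ([]; _∷_; here)
open import Level using (_⊔_)
open import Relation.Binary.PropositionalEquality
open import Relation.Nullary using (yes; no)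

∣p∪q∣+∣p∩q∣≡∣p∣+∣q∣ : ∀ {n} (p q : Subset n) → ∣ p ∪ q ∣ + ∣ p ∩ q ∣ ≡ ∣ p ∣ + ∣ q ∣
∣p∪q∣+∣p∩q∣≡∣p∣+∣q∣ []            []            = refl
∣p∪q∣+∣p∩q∣≡∣p∣+∣q∣ (outside ∷ p) (outside ∷ q) = ∣p∪q∣+∣p∩q∣≡∣p∣+∣q∣ p q
∣p∪q∣+∣p∩q∣≡∣p∣+∣q∣ (inside  ∷ p) (outside ∷ q) = cong suc (∣p∪q∣+∣p∩q∣≡∣p∣+∣q∣ p q)
∣p∪q∣+∣p∩q∣≡∣p∣+∣q∣ (outside ∷ p) (inside  ∷ q) =
  trans (cong suc (∣p∪q∣+∣p∩q∣≡∣p∣+∣q∣ p q)) (sym (+-suc ∣ p ∣ ∣ q ∣))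
∣p∪q∣+∣p∩q∣≡∣p∣+∣q∣ (inside  ∷ p) (inside  ∷ q) = cong suc (begin
  ∣ p ∪ q ∣ + suc ∣ p ∩ q ∣  ≡⟨ +-suc ∣ p ∪ q ∣ ∣ p ∩ q ∣ ⟩
  suc (∣ p ∪ q ∣ + ∣ p ∩ q ∣) ≡⟨ cong suc (∣p∪q∣+∣p∩q∣≡∣p∣+∣q∣ p q) ⟩
  suc (∣ p ∣ + ∣ q ∣)         ≡⟨ +-suc ∣ p ∣ ∣ q ∣ ⟨
  ∣ p ∣ + suc ∣ q ∣           ∎)
  where open ≡-Reasoning

∣q∩∁p∣+∣p∣≡∣q∣ : ∀ {n} {p q : Subset n} → p ⊆ q → ∣ q ∩ ∁ p ∣ + ∣ p ∣ ≡ ∣ q ∣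
∣q∩∁p∣+∣p∣≡∣q∣ {p = []}          {[]}          _   = refl
∣q∩∁p∣+∣p∣≡∣q∣ {p = outside ∷ p} {outside ∷ q} p⊆q = ∣q∩∁p∣+∣p∣≡∣q∣ (drop-∷-⊆ p⊆q)
∣q∩∁p∣+∣p∣≡∣q∣ {p = outside ∷ p} {inside  ∷ q} p⊆q = cong suc (∣q∩∁p∣+∣p∣≡∣q∣ (drop-∷-⊆ p⊆q))
∣q∩∁p∣+∣p∣≡∣q∣ {p = inside  ∷ p} {outside ∷ q} p⊆q with () ← p⊆q here
∣q∩∁p∣+∣p∣≡∣q∣ {p = inside  ∷ p} {inside  ∷ q} p⊆q =
  trans (+-suc _ ∣ p ∣) (cong suc (∣q∩∁p∣+∣p∣≡∣q∣ (drop-∷-⊆ p⊆q)))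

subsetOfSize : ∀ {n} (p : Subset n) k → k ≤ ∣ p ∣ → ∃[ q ] q ⊆ p × ∣ q ∣ ≡ k
subsetOfSize {n} _             zero    _ = ⊥ , ⊥⊆ , ∣⊥∣≡0 n
subsetOfSize     (outside ∷ p) (suc k) k<∣p∣ =
  let q , q⊆p , ∣q∣≡k = subsetOfSize p (suc k) k<∣p∣ in outside ∷ q , out⊆ q⊆p , ∣q∣≡k
subsetOfSize     (inside  ∷ p) (suc k) (s≤s k≤∣p∣) =
  let q , q⊆p , ∣q∣≡k = subsetOfSize p k k≤∣p∣ in inside ∷ q , in⊆in q⊆p , cong suc ∣q∣≡k

module _ {n : ℕ} where

  open ≡-Reasoning

  ∪-lub : ∀ {p q r : Subset n} → p ⊆ r → q ⊆ r → p ∪ q ⊆ r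
  ∪-lub {p} {q} p⊆r q⊆r x∈p∪q with x∈p∪q⁻ p q x∈p∪q
  ... | inj₁ x∈p = p⊆r x∈p
  ... | inj₂ x∈q = q⊆r x∈q

  ⊆∁⇒∩≡⊥ : ∀ {p q : Subset n} → q ⊆ ∁ p → p ∩ q ≡ ⊥
  ⊆∁⇒∩≡⊥ {p} {q} q⊆∁p = Empty-unique λ (_ , x∈p∩q) →
    let x∈p , x∈q = x∈p∩q⁻ p q x∈p∩q in x∈∁p⇒x∉p (q⊆∁p x∈q) x∈p

  p⊆q⇒∣p∩∁q∣≡0 : ∀ {p q : Subset n} → p ⊆ q → ∣ p ∩ ∁ q ∣ ≡ 0
  p⊆q⇒∣p∩∁q∣≡0 p⊆q = trans (cong ∣_∣ (⊆∁⇒∩≡⊥ (p⊆q⇒∁p⊇∁q p⊆q))) (∣⊥∣≡0 n)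

  ∣p∪q∣≡∣p∣+∣q∣ : ∀ (p q : Subset n) → p ∩ q ≡ ⊥ → ∣ p ∪ q ∣ ≡ ∣ p ∣ + ∣ q ∣
  ∣p∪q∣≡∣p∣+∣q∣ p q p∩q≡⊥ = begin
    ∣ p ∪ q ∣             ≡⟨ +-identityʳ ∣ p ∪ q ∣ ⟨
    ∣ p ∪ q ∣ + 0         ≡⟨ cong (∣ p ∪ q ∣ +_) (trans (cong ∣_∣ p∩q≡⊥) (∣⊥∣≡0 n)) ⟨
    ∣ p ∪ q ∣ + ∣ p ∩ q ∣ ≡⟨ ∣p∪q∣+∣p∩q∣≡∣p∣+∣q∣ p q ⟩
    ∣ p ∣ + ∣ q ∣         ∎

  ⊆∪∩∁ : ∀ {p q x : Subset n} → x ⊆ q → p ⊆ q ∪ p ∩ ∁ x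
  ⊆∪∩∁ {x = x} x⊆q {i} i∈p with i ∈? x
  ... | yes i∈x = x∈p∪q⁺ (inj₁ (x⊆q i∈x))
  ... | no  i∉x = x∈p∪q⁺ (inj₂ (x∈p∩q⁺ (i∈p , x∉p⇒x∈∁p i∉x)))

  exchange : Subset n → Subset n → Subset n → Subset n
  exchange p x y = p ∩ ∁ x ∪ y

  ∣exchange∣≡∣p∣ : ∀ {p x y : Subset n} → x ⊆ p → y ⊆ ∁ p → ∣ y ∣ ≡ ∣ x ∣ → ∣ exchange p x y ∣ ≡ ∣ p ∣
  ∣exchange∣≡∣p∣ {p} {x} {y} x⊆p y⊆∁p ∣y∣≡∣x∣ = begin
    ∣ p ∩ ∁ x ∪ y ∣       ≡⟨ ∣p∪q∣≡∣p∣+∣q∣ (p ∩ ∁ x) y (⊆∁⇒∩≡⊥ y⊆∁[p∩∁x]) ⟩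
    ∣ p ∩ ∁ x ∣ + ∣ y ∣   ≡⟨ cong (∣ p ∩ ∁ x ∣ +_) ∣y∣≡∣x∣ ⟩
    ∣ p ∩ ∁ x ∣ + ∣ x ∣   ≡⟨ ∣q∩∁p∣+∣p∣≡∣q∣ x⊆p ⟩
    ∣ p ∣                 ∎
    where
    y⊆∁[p∩∁x] : y ⊆ ∁ (p ∩ ∁ x)
    y⊆∁[p∩∁x] = ⊆-trans y⊆∁p (p⊆q⇒∁p⊇∁q (p∩q⊆p p (∁ x)))

  ∣q∩exchange∣+∣x∣≡∣q∩p∣ : ∀ {p q x y : Subset n} → x ⊆ q ∩ p → y ⊆ ∁ q →
                           ∣ q ∩ exchange p x y ∣ + ∣ x ∣ ≡ ∣ q ∩ p ∣
  ∣q∩exchange∣+∣x∣≡∣q∩p∣ {p} {q} {x} {y} x⊆q∩p y⊆∁q = begin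
    ∣ q ∩ (p ∩ ∁ x ∪ y) ∣ + ∣ x ∣ ≡⟨ cong (λ s → ∣ s ∣ + ∣ x ∣) q∩exchange≡q∩p∩∁x ⟩
    ∣ (q ∩ p) ∩ ∁ x ∣ + ∣ x ∣     ≡⟨ ∣q∩∁p∣+∣p∣≡∣q∣ x⊆q∩p ⟩
    ∣ q ∩ p ∣                     ∎
    where
    q∩exchange≡q∩p∩∁x : q ∩ (p ∩ ∁ x ∪ y) ≡ (q ∩ p) ∩ ∁ x
    q∩exchange≡q∩p∩∁x = begin
      q ∩ (p ∩ ∁ x ∪ y)       ≡⟨ ∩-distribˡ-∪ q (p ∩ ∁ x) y ⟩
      q ∩ (p ∩ ∁ x) ∪ q ∩ y   ≡⟨ cong (q ∩ (p ∩ ∁ x) ∪_) (⊆∁⇒∩≡⊥ y⊆∁q) ⟩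
      q ∩ (p ∩ ∁ x) ∪ ⊥       ≡⟨ ∪-identityʳ (q ∩ (p ∩ ∁ x)) ⟩
      q ∩ (p ∩ ∁ x)           ≡⟨ ∩-assoc q p (∁ x) ⟨
      (q ∩ p) ∩ ∁ x           ∎

module Walks {a p ℓ} {V : Set a} (P : V → Set p) (_~_ : V → V → Set ℓ) where

  Walk : V → V → ℕ → Set (a ⊔ p ⊔ ℓ)
  Walk x y L = Σ (ℕ → V) λ f →
      ((i : ℕ) → 1 ≤ i → i ≤ L → P (f i))
    × ((i : ℕ) → 1 ≤ i → i < L → f i ~ f (suc i))
    × f 1 ≡ x
    × f L ≡ y

  walk-single : ∀ {x} → P x → Walk x x 1
  walk-single {x} px = (λ _ → x) , (λ _ _ _ → px) , (λ { (suc _) _ (s≤s ()) }) , refl , refl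

  walk-cons : ∀ {x y z L} → P x → x ~ y → Walk y z (suc L) → Walk x z (suc (suc L))
  walk-cons {x} {L = L} px x~y (f , Pf , ~f , f1≡y , fL≡z) = g , Pg , ~g , refl , fL≡z
    where
    g : ℕ → V
    g (suc (suc i)) = f (suc i)
    g _             = x

    Pg : (i : ℕ) → 1 ≤ i → i ≤ suc (suc L) → P (g i)
    Pg 1             _ _         = px
    Pg (suc (suc i)) _ (s≤s i<L) = Pf (suc i) (s≤s z≤n) i<L

    ~g : (i : ℕ) → 1 ≤ i → i < suc (suc L) → g i ~ g (suc i)
    ~g 1             _ _         = subst (x ~_) (sym f1≡y) x~y
    ~g (suc (suc i)) _ (s≤s i<L) = ~f (suc i) (s≤s z≤n) i<L

open Walks using (Walk)

a+t⊓k≡k+t⇒a≤[1+m]t : ∀ {a k} t m → a + t ⊓ k ≡ k + t → k + t ≤ suc (suc m) * t → a ≤ suc m * t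
a+t⊓k≡k+t⇒a≤[1+m]t {a} {k} t m a+t⊓k≡k+t k+t≤[2+m]t with ≤-total t k
... | inj₁ t≤k = +-cancelʳ-≤ t a (suc m * t) (begin
  a + t          ≡⟨ cong (a +_) (m≤n⇒m⊓n≡m t≤k) ⟨
  a + t ⊓ k      ≡⟨ a+t⊓k≡k+t ⟩
  k + t          ≤⟨ k+t≤[2+m]t ⟩
  t + suc m * t  ≡⟨ +-comm t (suc m * t) ⟩
  suc m * t + t  ∎)
  where open ≤-Reasoning
... | inj₂ k≤t = begin
  a              ≡⟨ +-cancelʳ-≡ k a t (trans (sym (cong (a +_) (m≥n⇒m⊓n≡n k≤t))) (trans a+t⊓k≡k+t (+-comm k t))) ⟩
  t              ≤⟨ m≤m+n t (m * t) ⟩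
  suc m * t      ∎
  where open ≤-Reasoning

t+2r≡r+t+r : ∀ t r → t + 2 * r ≡ r + t + r
t+2r≡r+t+r = solve-∀

t+2r+t≡[r+t]+[r+t] : ∀ t r → t + 2 * r + t ≡ (r + t) + (r + t)
t+2r+t≡[r+t]+[r+t] = solve-∀

m≤[1+m/t]*t : ∀ m t .{{_ : NonZero t}} → m ≤ suc (m / t) * t
m≤[1+m/t]*t m t = begin
  m                 ≡⟨ m≡m%n+[m/n]*n m t ⟩
  m % t + m / t * t ≤⟨ +-monoˡ-≤ (m / t * t) (<⇒≤ (m%n<n m t)) ⟩
  t + m / t * t     ∎
  where open ≤-Reasoning

module _ {n : ℕ} (t r : ℕ) {T : Subset n} (∣T∣≡t+2r : ∣ T ∣ ≡ t + 2 * r) where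

  open ≡-Reasoning

  _~_ : Subset n → Subset n → Set
  V ~ W = ∣ V ∩ W ∣ ≡ t

  ~-sym : ∀ {V W} → V ~ W → W ~ V
  ~-sym {V} {W} = trans (cong ∣_∣ (∩-comm W V))

  ∣T∩∁[V∪W]∣+t≡∣V∩W∣ : ∀ {V W} → InBinom T (r + t) V → InBinom T (r + t) W →
                       ∣ T ∩ ∁ (V ∪ W) ∣ + t ≡ ∣ V ∩ W ∣
  ∣T∩∁[V∪W]∣+t≡∣V∩W∣ {V} {W} (V⊆T , ∣V∣≡r+t) (W⊆T , ∣W∣≡r+t) =
    +-cancelʳ-≡ ∣ V ∪ W ∣ _ _ (begin
      ∣ T ∩ ∁ (V ∪ W) ∣ + t + ∣ V ∪ W ∣   ≡⟨ xy∙z≈xz∙y (∣ T ∩ ∁ (V ∪ W) ∣) t (∣ V ∪ W ∣) ⟩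
      ∣ T ∩ ∁ (V ∪ W) ∣ + ∣ V ∪ W ∣ + t   ≡⟨ cong (_+ t) (∣q∩∁p∣+∣p∣≡∣q∣ (∪-lub V⊆T W⊆T)) ⟩
      ∣ T ∣ + t                           ≡⟨ cong (_+ t) ∣T∣≡t+2r ⟩
      t + 2 * r + t                       ≡⟨ t+2r+t≡[r+t]+[r+t] t r ⟩
      (r + t) + (r + t)                   ≡⟨ cong₂ _+_ ∣V∣≡r+t ∣W∣≡r+t ⟨
      ∣ V ∣ + ∣ W ∣                       ≡⟨ ∣p∪q∣+∣p∩q∣≡∣p∣+∣q∣ V W ⟨
      ∣ V ∪ W ∣ + ∣ V ∩ W ∣               ≡⟨ +-comm ∣ V ∪ W ∣ ∣ V ∩ W ∣ ⟩
      ∣ V ∩ W ∣ + ∣ V ∪ W ∣               ∎)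

  t≤∣V∩W∣ : ∀ {V W} → InBinom T (r + t) V → InBinom T (r + t) W → t ≤ ∣ V ∩ W ∣
  t≤∣V∩W∣ v w = subst (t ≤_) (∣T∩∁[V∪W]∣+t≡∣V∩W∣ v w) (m≤n+m t _)

  T⊆V∪W⇒V~W : ∀ {V W} → InBinom T (r + t) V → InBinom T (r + t) W → T ⊆ V ∪ W → V ~ W
  T⊆V∪W⇒V~W v w T⊆V∪W =
    trans (sym (∣T∩∁[V∪W]∣+t≡∣V∩W∣ v w)) (cong (_+ t) (p⊆q⇒∣p∩∁q∣≡0 T⊆V∪W))

  T∩∁X-neighbour : ∀ {V X} → InBinom T (r + t) V → X ⊆ V → ∣ X ∣ ≡ r →
                   InBinom T (r + t) (T ∩ ∁ X) × V ~ (T ∩ ∁ X)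
  T∩∁X-neighbour {V} {X} v@(V⊆T , _) X⊆V ∣X∣≡r = c , T⊆V∪W⇒V~W v c (⊆∪∩∁ X⊆V)
    where
    ∣T∩∁X∣+r≡r+t+r : ∣ T ∩ ∁ X ∣ + r ≡ r + t + r
    ∣T∩∁X∣+r≡r+t+r = begin
      ∣ T ∩ ∁ X ∣ + r      ≡⟨ cong (∣ T ∩ ∁ X ∣ +_) ∣X∣≡r ⟨
      ∣ T ∩ ∁ X ∣ + ∣ X ∣  ≡⟨ ∣q∩∁p∣+∣p∣≡∣q∣ (⊆-trans X⊆V V⊆T) ⟩
      ∣ T ∣                ≡⟨ ∣T∣≡t+2r ⟩
      t + 2 * r            ≡⟨ t+2r≡r+t+r t r ⟩
      r + t + r            ∎
    c : InBinom T (r + t) (T ∩ ∁ X)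
    c = p∩q⊆p T (∁ X) , +-cancelʳ-≡ r _ _ ∣T∩∁X∣+r≡r+t+r

  commonNeighbour : ∀ {V W} → InBinom T (r + t) V → InBinom T (r + t) W → r ≤ ∣ V ∩ W ∣ →
                    ∃[ C ] InBinom T (r + t) C × V ~ C × C ~ W
  commonNeighbour {V} {W} v w r≤∣V∩W∣ =
    let X , X⊆V∩W , ∣X∣≡r = subsetOfSize (V ∩ W) r r≤∣V∩W∣
        c , V~C = T∩∁X-neighbour v (⊆-trans X⊆V∩W (p∩q⊆p V W)) ∣X∣≡r
        _ , W~C = T∩∁X-neighbour w (⊆-trans X⊆V∩W (p∩q⊆q V W)) ∣X∣≡r
    in T ∩ ∁ X , c , V~C , ~-sym {W} W~C

  exchange-closer : ∀ {A B J' J} → InBinom T (r + t) B → J' ⊆ A ∩ B → J ⊆ T ∩ ∁ (A ∪ B) →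
                    ∣ J ∣ ≡ ∣ J' ∣ → ∣ J' ∣ ≤ t →
                    let D = exchange B J' J in
                    InBinom T (r + t) D × r ≤ ∣ B ∩ D ∣ × ∣ A ∩ D ∣ + ∣ J' ∣ ≡ ∣ A ∩ B ∣
  exchange-closer {A} {B} {J'} {J} (B⊆T , ∣B∣≡r+t) J'⊆A∩B J⊆T∩∁[A∪B] ∣J∣≡∣J'∣ ∣J'∣≤t =
    (D⊆T , trans (∣exchange∣≡∣p∣ J'⊆B J⊆∁B ∣J∣≡∣J'∣) ∣B∣≡r+t) , r≤∣B∩D∣ ,
    ∣q∩exchange∣+∣x∣≡∣q∩p∣ J'⊆A∩B J⊆∁A
    where
    J⊆∁[A∪B] : J ⊆ ∁ (A ∪ B)
    J⊆∁[A∪B] = ⊆-trans J⊆T∩∁[A∪B] (p∩q⊆q T _)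
    J⊆∁A : J ⊆ ∁ A
    J⊆∁A = ⊆-trans J⊆∁[A∪B] (p⊆q⇒∁p⊇∁q (p⊆p∪q B))
    J⊆∁B : J ⊆ ∁ B
    J⊆∁B = ⊆-trans J⊆∁[A∪B] (p⊆q⇒∁p⊇∁q (q⊆p∪q A B))
    J'⊆B : J' ⊆ B
    J'⊆B = ⊆-trans J'⊆A∩B (p∩q⊆q A B)
    D⊆T : exchange B J' J ⊆ T
    D⊆T = ∪-lub (⊆-trans (p∩q⊆p B (∁ J')) B⊆T) (⊆-trans J⊆T∩∁[A∪B] (p∩q⊆p T _))
    ∣B∩D∣+∣J'∣≡r+t : ∣ B ∩ exchange B J' J ∣ + ∣ J' ∣ ≡ r + t
    ∣B∩D∣+∣J'∣≡r+t = begin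
      ∣ B ∩ exchange B J' J ∣ + ∣ J' ∣ ≡⟨ ∣q∩exchange∣+∣x∣≡∣q∩p∣ (subst (J' ⊆_) (sym (∩-idem B)) J'⊆B) J⊆∁B ⟩
      ∣ B ∩ B ∣                        ≡⟨ cong ∣_∣ (∩-idem B) ⟩
      ∣ B ∣                            ≡⟨ ∣B∣≡r+t ⟩
      r + t                            ∎
    r≤∣B∩D∣ : r ≤ ∣ B ∩ exchange B J' J ∣
    r≤∣B∩D∣ = +-cancelʳ-≤ ∣ J' ∣ r _ (subst (r + ∣ J' ∣ ≤_) (sym ∣B∩D∣+∣J'∣≡r+t) (+-monoʳ-≤ r ∣J'∣≤t))

  closer : ∀ {A B} → InBinom T (r + t) A → InBinom T (r + t) B →
           ∀ j → j ≤ t → j ≤ ∣ T ∩ ∁ (A ∪ B) ∣ →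
           ∃[ D ] InBinom T (r + t) D × r ≤ ∣ B ∩ D ∣ × ∣ A ∩ D ∣ + j ≡ ∣ A ∩ B ∣
  closer {A} {B} a b j j≤t j≤∣T∩∁[A∪B]∣ with subsetOfSize (A ∩ B) j (≤-trans j≤t (t≤∣V∩W∣ a b))
  ... | J' , J'⊆A∩B , refl =
    let J , J⊆T∩∁[A∪B] , ∣J∣≡∣J'∣ = subsetOfSize (T ∩ ∁ (A ∪ B)) ∣ J' ∣ j≤∣T∩∁[A∪B]∣
    in exchange B J' J , exchange-closer b J'⊆A∩B J⊆T∩∁[A∪B] ∣J∣≡∣J'∣ j≤t

  open Walks (InBinom T (r + t)) _~_ using (walk-single; walk-cons)

  walkTo : ∀ {A} → InBinom T (r + t) A → ∀ m {B} → InBinom T (r + t) B → ∣ A ∩ B ∣ ≤ suc m * t →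
           Walk (InBinom T (r + t)) _~_ B A (suc m * 2)
  walkTo {A} a zero {B} b ∣A∩B∣≤t = walk-cons b (~-sym {A} A~B) (walk-single a)
    where
    A~B : A ~ B
    A~B = ≤-antisym (subst (∣ A ∩ B ∣ ≤_) (+-identityʳ t) ∣A∩B∣≤t) (t≤∣V∩W∣ a b)
  walkTo {A} a (suc m) {B} b ∣A∩B∣≤[2+m]t =
    let k = ∣ T ∩ ∁ (A ∪ B) ∣
        k+t≡∣A∩B∣ = ∣T∩∁[V∪W]∣+t≡∣V∩W∣ a b
        D , d , r≤∣B∩D∣ , ∣A∩D∣+t⊓k≡∣A∩B∣ = closer a b (t ⊓ k) (m⊓n≤m t k) (m⊓n≤n t k)
        C , c , B~C , C~D = commonNeighbour b d r≤∣B∩D∣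
        ∣A∩D∣≤[1+m]t = a+t⊓k≡k+t⇒a≤[1+m]t t m (trans ∣A∩D∣+t⊓k≡∣A∩B∣ (sym k+t≡∣A∩B∣))
                         (subst (_≤ suc (suc m) * t) (sym k+t≡∣A∩B∣) ∣A∩B∣≤[2+m]t)
    in walk-cons b B~C (walk-cons c C~D (walkTo a m d ∣A∩D∣≤[1+m]t))

lemma4p4 : (n t' r : ℕ) → 1 ≤ n → .{{_ : NonZero t'}} → 1 ≤ r →
    (T : Subset n) → ∣ T ∣ ≡ t' + 2 * r →
    (A B : Subset n) → InBinom T (r + t') A → InBinom T (r + t') B → A ≢ B →
    Σ (ℕ → Subset n) λ As →
      ((i : ℕ) → 1 ≤ i → i ≤ 2 * (∣ A ∩ B ∣ / t' + 1) → InBinom T (r + t') (As i))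
      × ((i : ℕ) → 1 ≤ i → i < 2 * (∣ A ∩ B ∣ / t' + 1) → ∣ As i ∩ As (suc i) ∣ ≡ t')
      × As 1 ≡ B
      × As (2 * (∣ A ∩ B ∣ / t' + 1)) ≡ A
lemma4p4 _ t' r _ _ T ∣T∣≡t'+2r A B a b _ =
  subst (Walk (InBinom T (r + t')) (λ V W → ∣ V ∩ W ∣ ≡ t') B A) [1+q]*2≡2*[q+1]
    (walkTo t' r ∣T∣≡t'+2r a q b (m≤[1+m/t]*t ∣ A ∩ B ∣ t'))
  where
  q = ∣ A ∩ B ∣ / t'
  [1+q]*2≡2*[q+1] : suc q * 2 ≡ 2 * (q + 1)
  [1+q]*2≡2*[q+1] = trans (*-comm (suc q) 2) (cong (2 *_) (+-comm 1 q))
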